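{- Let $G$ be a graph of order $n$ and let $D_n$ be a maximal Diophantine graph of order $n$. If $G$ is Diophantine, then $Cl(G)\le Cl(D_n)$.
   Context: All graphs are finite, simple and undirected. A graph $G$ with $n$ vertices is Diophantine if there is a bijection $f:V(G)\to\{1,\dots,n\}$ such that $\gcd(f(u),f(v))\mid n$ for every edge $uv$. A maximal Diophantine graph $D_n$ of order $n$ is a Diophantine graph of order $n$ such that adding any new edge yields a non-Diophantine graph. $Cl(H)$ denotes the clique number of a graph $H$. -}

module Defs where

open import Data.Nat using (ℕ; suc; _≤_)
open import Data.Nat.GCD using (gcd)
open import Data.Nat.Divisibility using (_∣_)
open import Data.Fin using (Fin; toℕ; _≟_)
open import Data.Fin.Subset using (Subset; _∈_; ∣_∣)
open import Data.Bool using (Bool; true; false; _∧_; _∨_)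
open import Data.Bool.Properties using (∨-comm; ∧-comm)
open import Data.Product using (Σ; ∃; _×_; _,_)
open import Function.Bundles using (_⤖_; Bijection)
open import Relation.Nullary using (¬_; yes; no; does)
open import Relation.Binary.PropositionalEquality using (_≡_; _≢_; refl; cong₂; sym)

record Graph (n : ℕ) : Set where
  field
    adj    : Fin n → Fin n → Bool
    adj-sym    : ∀ u v → adj u v ≡ adj v u
    adj-irrefl : ∀ v → adj v v ≡ false
open Graph public

-- Diophantine labeling: a bijection f : V(G) → {1,…,n}, realised as a
-- bijection Fin n → Fin n with label f(v) = 1 + toℕ (f v).
IsDiophantineLabeling : ∀ {n} → Graph n → Fin n ⤖ Fin n → Set
IsDiophantineLabeling {n} G f =
  ∀ u v → adj G u v ≡ true →
    gcd (suc (toℕ (Bijection.to f u))) (suc (toℕ (Bijection.to f v))) ∣ n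

IsDiophantine : ∀ {n} → Graph n → Set
IsDiophantine {n} G = Σ (Fin n ⤖ Fin n) (IsDiophantineLabeling G)

private
  isPair : ∀ {n} → Fin n → Fin n → Fin n → Fin n → Bool
  isPair u v x y = (does (x ≟ u) ∧ does (y ≟ v)) ∨ (does (x ≟ v) ∧ does (y ≟ u))

  isPair-sym : ∀ {n} (u v x y : Fin n) → isPair u v x y ≡ isPair u v y x
  isPair-sym u v x y
    rewrite ∧-comm (does (x ≟ u)) (does (y ≟ v))
          | ∧-comm (does (x ≟ v)) (does (y ≟ u))
    = ∨-comm (does (y ≟ v) ∧ does (x ≟ u)) (does (y ≟ u) ∧ does (x ≟ v))

  isPair-diag : ∀ {n} (u v x : Fin n) → u ≢ v → isPair u v x x ≡ false
  isPair-diag u v x u≢v with x ≟ u | x ≟ v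
  ... | yes refl | yes refl = Data.Empty.⊥-elim (u≢v refl)
    where import Data.Empty
  ... | yes _ | no _ = refl
  ... | no _ | yes _ = refl
  ... | no _ | no _ = refl

addEdge : ∀ {n} → Graph n → (u v : Fin n) → u ≢ v → Graph n
addEdge G u v u≢v = record
  { adj = λ x y → adj G x y ∨ isPair u v x y
  ; adj-sym = λ x y → cong₂ _∨_ (adj-sym G x y) (isPair-sym u v x y)
  ; adj-irrefl = λ x → cong₂ _∨_ (adj-irrefl G x) (isPair-diag u v x u≢v)
  }

IsMaximalDiophantine : ∀ {n} → Graph n → Set
IsMaximalDiophantine {n} D =
  IsDiophantine D ×
  (∀ (u v : Fin n) (u≢v : u ≢ v) → adj D u v ≡ false →
     ¬ IsDiophantine (addEdge D u v u≢v))

IsClique : ∀ {n} → Graph n → Subset n → Set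
IsClique G S = ∀ x y → x ∈ S → y ∈ S → x ≢ y → adj G x y ≡ true

IsCliqueNumber : ∀ {n} → Graph n → ℕ → Set
IsCliqueNumber G c =
  (∃ λ S → IsClique G S × ∣ S ∣ ≡ c) × (∀ S → IsClique G S → ∣ S ∣ ≤ c)

{-# OPTIONS --safe #-}
module Submission where

-- Let f label the maximal graph Dₙ and g label G, and let π = g⁻¹ ∘ f.
-- Whenever π x and π y are adjacent in G, the f-labels of x and y are the
-- g-labels of π x and π y, so their gcd divides n; maximality of Dₙ then
-- forces x and y to be adjacent in Dₙ (otherwise f would still label
-- Dₙ + xy). Hence the preimage under π of a maximum clique of G is a clique
-- of Dₙ of the same size.

open import Defs
open import Data.Nat using (ℕ; suc; _≤_)
open import Data.Nat.GCD using (gcd; gcd-comm)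
open import Data.Nat.Divisibility using (_∣_)
open import Data.Nat.Properties using (+-0-commutativeMonoid; module ≤-Reasoning)
open import Data.Fin using (Fin; toℕ; _≟_)
open import Data.Fin.Permutation using (Permutation′; _⟨$⟩ʳ_)
open import Data.Fin.Subset using (Subset; _∈_; ∣_∣)
open import Data.Bool using (Bool; true; false; if_then_else_)
open import Data.Vec using ([]; _∷_; lookup; tabulate)
open import Data.Vec.Properties using (lookup∘tabulate; []=⇒lookup; lookup⇒[]=)
open import Data.Product using (_,_)
open import Function.Base using (_∘_)
open import Function.Bundles using (_⤖_; Bijection; Inverse; Injection)
open import Function.Definitions using (Injective)
open import Function.Properties.Bijection using (⤖⇒↔)
open import Function.Properties.Inverse using (↔⇒↣)
open import Function.Construct.Composition using (_↔-∘_)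
open import Function.Construct.Symmetry using (↔-sym)
open import Relation.Nullary using (yes; no; contradiction)
open import Relation.Binary.PropositionalEquality
open import Algebra.Properties.CommutativeMonoid.Sum +-0-commutativeMonoid
  using (sum; sum-permute; sum-cong-≗)

preimage : ∀ {m n} → (Fin m → Fin n) → Subset n → Subset m
preimage p S = tabulate (lookup S ∘ p)

∈-preimage⁻ : ∀ {m n} (p : Fin m → Fin n) (S : Subset n) {x} →
              x ∈ preimage p S → p x ∈ S
∈-preimage⁻ p S {x} x∈ =
  lookup⇒[]= (p x) S (trans (sym (lookup∘tabulate (lookup S ∘ p) x)) ([]=⇒lookup x∈))

indicator : Bool → ℕ
indicator b = if b then 1 else 0

∣p∣≡sum : ∀ {n} (S : Subset n) → ∣ S ∣ ≡ sum (indicator ∘ lookup S)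
∣p∣≡sum []          = refl
∣p∣≡sum (true ∷ S)  = cong suc (∣p∣≡sum S)
∣p∣≡sum (false ∷ S) = ∣p∣≡sum S

∣preimage∣≡∣p∣ : ∀ {n} (π : Permutation′ n) (S : Subset n) →
                 ∣ preimage (π ⟨$⟩ʳ_) S ∣ ≡ ∣ S ∣
∣preimage∣≡∣p∣ π S = begin
  ∣ preimage (π ⟨$⟩ʳ_) S ∣                       ≡⟨ ∣p∣≡sum (preimage (π ⟨$⟩ʳ_) S) ⟩
  sum (λ i → indicator (lookup (preimage (π ⟨$⟩ʳ_) S) i))
      ≡⟨ sum-cong-≗ (cong indicator ∘ lookup∘tabulate (lookup S ∘ (π ⟨$⟩ʳ_))) ⟩
  sum (λ i → indicator (lookup S (π ⟨$⟩ʳ i)))   ≡⟨ sum-permute (indicator ∘ lookup S) π ⟨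
  sum (λ i → indicator (lookup S i))             ≡⟨ ∣p∣≡sum S ⟨
  ∣ S ∣                                          ∎
  where open ≡-Reasoning

IsClique-preimage : ∀ {m n} (G : Graph n) (H : Graph m) (p : Fin m → Fin n) →
  Injective _≡_ _≡_ p →
  (∀ x y → x ≢ y → adj G (p x) (p y) ≡ true → adj H x y ≡ true) →
  ∀ {S} → IsClique G S → IsClique H (preimage p S)
IsClique-preimage G H p p-inj edge {S} S-clique x y x∈ y∈ x≢y =
  edge x y x≢y (S-clique (p x) (p y) (∈-preimage⁻ p S x∈) (∈-preimage⁻ p S y∈) (x≢y ∘ p-inj))

label : ∀ {n} → Fin n ⤖ Fin n → Fin n → ℕ
label f u = suc (toℕ (Bijection.to f u))

addEdge-IsDiophantineLabeling : ∀ {n} (D : Graph n) (f : Fin n ⤖ Fin n) →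
  IsDiophantineLabeling D f → ∀ {x y} (x≢y : x ≢ y) →
  gcd (label f x) (label f y) ∣ n → IsDiophantineLabeling (addEdge D x y x≢y) f
addEdge-IsDiophantineLabeling {n} D f f-labels {x} {y} _ xy∣n u v uv∈D+xy
  with adj D u v in uv∈D
... | true = f-labels u v uv∈D
... | false with u ≟ x | v ≟ y | u ≟ y | v ≟ x
...   | yes refl | yes refl | _        | _        = xy∣n
...   | _        | _        | yes refl | yes refl = subst (_∣ n) (gcd-comm (label f x) (label f y)) xy∣n
...   | yes _    | no _     | no _     | _        = contradiction uv∈D+xy λ ()
...   | yes _    | no _     | yes _    | no _     = contradiction uv∈D+xy λ ()
...   | no _     | _        | no _     | _        = contradiction uv∈D+xy λ ()
...   | no _     | _        | yes _    | no _     = contradiction uv∈D+xy λ ()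

IsMaximalDiophantine⇒adj : ∀ {n} (D : Graph n) → IsMaximalDiophantine D →
  ∀ f → IsDiophantineLabeling D f → ∀ {x y} → x ≢ y →
  gcd (label f x) (label f y) ∣ n → adj D x y ≡ true
IsMaximalDiophantine⇒adj D (_ , maximal) f f-labels {x} {y} x≢y xy∣n
  with adj D x y in xy∉D
... | true  = refl
... | false = contradiction (f , addEdge-IsDiophantineLabeling D f f-labels x≢y xy∣n)
                            (maximal x y x≢y xy∉D)

corollary3p5 : (n : ℕ) (G Dn : Graph n) → IsMaximalDiophantine Dn → IsDiophantine G →
    (c d : ℕ) → IsCliqueNumber G c → IsCliqueNumber Dn d → c ≤ d
corollary3p5 n G Dn Dn-maximal@((f , f-labels) , _) (g , g-labels) c d
             ((S , S-clique , ∣S∣≡c) , _) (_ , Dn-bound) = begin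
  c      ≡⟨ ∣S∣≡c ⟨
  ∣ S ∣  ≡⟨ ∣preimage∣≡∣p∣ π S ⟨
  ∣ T ∣  ≤⟨ Dn-bound T T-clique ⟩
  d      ∎
  where
  open ≤-Reasoning

  π : Permutation′ n
  π = ↔-sym (⤖⇒↔ g) ↔-∘ ⤖⇒↔ f

  label-π : ∀ x → label g (π ⟨$⟩ʳ x) ≡ label f x
  label-π x = cong (suc ∘ toℕ) (Inverse.strictlyInverseˡ (⤖⇒↔ g) (Bijection.to f x))

  edge : ∀ x y → x ≢ y → adj G (π ⟨$⟩ʳ x) (π ⟨$⟩ʳ y) ≡ true → adj Dn x y ≡ true
  edge x y x≢y πxπy∈G = IsMaximalDiophantine⇒adj Dn Dn-maximal f f-labels x≢y
    (subst₂ (λ a b → gcd a b ∣ n) (label-π x) (label-π y) (g-labels _ _ πxπy∈G))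

  T : Subset n
  T = preimage (π ⟨$⟩ʳ_) S

  T-clique : IsClique Dn T
  T-clique = IsClique-preimage G Dn (π ⟨$⟩ʳ_) (Injection.injective (↔⇒↣ π)) edge S-clique
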